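{- Let $A_m\in\mathbf{U}_m^{(0,\frac12,1)}$. If for some $\alpha\subset I_m$ with $k=|\alpha|\ge 3$ the principal submatrix $A_\alpha$ (regarded as a $k\times k$ matrix) is an $F_k$-matrix, then $A_m$ is not an extreme point of $\mathbf{U}_m$.
   Context: $I_m=\{1,\dots,m\}$. $\mathbf{U}_m$ is the set of real $m\times m$ matrices $A_m=(a_{ij})$ with $a_{ij}=a_{ji}\ge 0$ for all $i,j$ and $\sum_{i,j\in\alpha}a_{ij}\le|\alpha|$ for every $\alpha\subset I_m$ ($|\alpha|$ the cardinality). $\mathbf{U}_m^{(0,\frac12,1)}=\{A_m\in\mathbf{U}_m: a_{ii}\in\{0,1\},\ a_{ij}\in\{0,\frac12,1\}\ \forall i,j\}$. The principal submatrix is $A_\alpha=(a_{ij})_{i,j\in\alpha}$. A nonempty index set $\beta$ is saturated for a matrix $B=(b_{ij})$ if $\sum_{i,j\in\beta}b_{ij}=|\beta|$. An $F_k$-matrix is a matrix $B\in\mathbf{U}_k^{(0,\frac12,1)}$ such that $I_k$ is saturated for $B$ and no nonempty proper subset of $I_k$ is saturated for $B$. -}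

module Defs where

open import Data.Nat using (ℕ; zero; suc)
open import Data.Integer using (+_)
open import Data.Fin using (Fin; zero; suc; _<_)
open import Data.Fin.Subset using (Subset; Side; inside; outside; ∣_∣; ⊤; Nonempty)
open import Data.Vec using (lookup)
open import Data.Rational using (ℚ; 0ℚ; 1ℚ; ½; _+_; _*_; _-_; _≤_; _<_; _/_)
open import Data.Product using (_×_; Σ; ∃)
open import Relation.Binary.PropositionalEquality using (_≡_; _≢_)
open import Relation.Nullary using (¬_)
open import Data.Sum using (_⊎_)

-- real m×m matrices, with entries taken in ℚ
Matrix : ℕ → Set
Matrix m = Fin m → Fin m → ℚ

sumFin : ∀ {n} → (Fin n → ℚ) → ℚ
sumFin {zero}  f = 0ℚ
sumFin {suc n} f = f zero + sumFin {n} (λ i → f (suc i))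

ind : Side → ℚ
ind inside  = 1ℚ
ind outside = 0ℚ

sumSub : ∀ {m} → Subset m → Matrix m → ℚ
sumSub α A = sumFin (λ i → sumFin (λ j → ind (lookup α i) * ind (lookup α j) * A i j))

card : ∀ {m} → Subset m → ℚ
card α = + ∣ α ∣ / 1

InU : ∀ {m} → Matrix m → Set
InU {m} A = (∀ i j → A i j ≡ A j i)
          × (∀ i j → 0ℚ ≤ A i j)
          × (∀ (α : Subset m) → sumSub α A ≤ card α)

InU012 : ∀ {m} → Matrix m → Set
InU012 {m} A = InU A
             × (∀ i → A i i ≡ 0ℚ ⊎ A i i ≡ 1ℚ)
             × (∀ i j → A i j ≡ 0ℚ ⊎ A i j ≡ ½ ⊎ A i j ≡ 1ℚ)

Saturated : ∀ {k} → Matrix k → Subset k → Set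
Saturated B β = Nonempty β × (sumSub β B ≡ card β)

IsF : ∀ {k} → Matrix k → Set
IsF {k} B = InU012 B
          × Saturated B ⊤
          × (∀ (β : Subset k) → Nonempty β → β ≢ ⊤ → ¬ Saturated B β)

-- principal submatrix A_α, where α = {f 0 < f 1 < … < f (k-1)} is given by
-- its strictly increasing enumeration f, regarded as a k×k matrix
principal : ∀ {m k} → Matrix m → (Fin k → Fin m) → Matrix k
principal A f i j = A (f i) (f j)

StrictlyIncreasing : ∀ {k m} → (Fin k → Fin m) → Set
StrictlyIncreasing f = ∀ i j → i Data.Fin.< j → f i Data.Fin.< f j

IsExtremeU : ∀ {m} → Matrix m → Set
IsExtremeU {m} A = InU A
  × (∀ (B C : Matrix m) (t : ℚ) → InU B → InU C → 0ℚ Data.Rational.< t → t Data.Rational.< 1ℚ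
       → (∀ i j → A i j ≡ t * B i j + (1ℚ - t) * C i j)
       → ∀ i j → B i j ≡ C i j)

module Submission where

-- Write P = A_α for the F_k block, α = image f, and call |χ| − Σ_{i,j∈χ} a_ij the deficiency of χ.
-- The entries of P lie in {0, ½, 1}, so its sums are half-integers and every nonempty proper
-- β ⊂ α, not being saturated, has deficiency ≥ ½. Because α is saturated for A, the sum over χ is
-- supermodular (a_ij ≥ 0) and |χ| is modular, the deficiency of χ is at least that of χ ∩ α:
-- every χ cutting α has deficiency ≥ ½. Since Σ_α P = k ≥ 3 while entries are ≤ 1, P has two
-- positive entries (a,b), (c,d) with (c,d) ∉ {(a,b), (b,a)}, and positive entries are ≥ ½.
-- With p, q, r, s the images of a, b, c, d, adding ¼(E_pq + E_qp) − ¼(E_rs + E_sr) raises a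
-- subset sum by ½ only when χ contains p, q but misses r or s, i.e. when χ cuts α. Hence A plus
-- or minus this perturbation stays in U_m, and A is the midpoint of two distinct points of U_m.

open import Defs
open import Data.Fin using (Fin)
open import Data.Product using (_×_; Σ)
open import Relation.Nullary using (¬_)

-- ℚ's _≤_ is opened only inside this module, so that it does not clash with ℕ's _≤_ in the
-- statement of proposition3p9.
module _ where
  open import Algebra.Bundles using (CommutativeMonoid; CommutativeRing)
  open import Data.Bool using (Bool; true; false; _∧_; _∨_)
  open import Data.Fin using (zero; suc; _≟_)
  import Data.Fin.Properties as Finₚ
  open import Data.Fin.Subset using (Subset; Nonempty; inside; outside; ∣_∣; ⊤)
  open import Data.Fin.Subset.Properties using (∣⊤∣≡n)
  open import Data.Integer as ℤ using (+_)
  import Data.Integer.Properties as ℤₚ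
  open import Data.Nat as ℕ using (ℕ)
  import Data.Nat.Coprimality as Coprimality
  import Data.Nat.Properties as ℕₚ
  open import Data.Product using (_,_; proj₁; proj₂; ∃; ∃₂)
  open import Data.Rational using (ℚ; mkℚ; 0ℚ; 1ℚ; ½; _+_; _*_; _-_; -_; _≤_; _<_; _/_; *≤*; nonNegative)
  import Data.Rational.Properties as ℚₚ
  open import Data.Rational.Solver using (module +-*-Solver)
  open +-*-Solver using (solve; _:+_; _:*_; _:-_; :-_; _:=_; con)
  open import Data.Sum using (_⊎_; inj₁; inj₂)
  open import Data.Vec using (_∷_; []; lookup; tabulate)
  import Data.Vec.Properties as Vecₚ
  open import Function using (_∘_; mk⇔)
  open import Function.Definitions using (Injective)
  open import Relation.Binary using (tri<; tri≈; tri>)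
  open import Relation.Binary.PropositionalEquality
    using (_≡_; _≢_; _≗_; refl; sym; trans; cong; cong₂; subst; subst₂; module ≡-Reasoning)
  open import Relation.Nullary using (yes; no; does; contradiction)
  open import Relation.Nullary.Decidable using (True; toWitness; dec-false; does-⇔; _×-dec_)
  open import Algebra.Properties.CommutativeSemigroup (CommutativeMonoid.commutativeSemigroup ℚₚ.+-0-commutativeMonoid)
    using (xy∙z≈xz∙y; xy∙z≈x∙zy)
  open import Algebra.Properties.Semiring.Sum (CommutativeRing.semiring ℚₚ.+-*-commutativeRing)
    using (sum; sum-syntax; sum-cong-≗; ∑-distrib-+; ∑-comm; *-distribˡ-sum; *-distribʳ-sum; sum-replicate-zero)

  fromℕ : ℕ → ℚ
  fromℕ n = + n / 1

  fromℕ≡mkℚ : ∀ n → fromℕ n ≡ mkℚ (+ n) 0 (Coprimality.sym (Coprimality.1-coprimeTo n))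
  fromℕ≡mkℚ n = ℚₚ.normalize-coprime (Coprimality.sym (Coprimality.1-coprimeTo n))

  fromℕ-+ : ∀ a b → fromℕ (a ℕ.+ b) ≡ fromℕ a + fromℕ b
  fromℕ-+ a b = begin
    + (a ℕ.+ b) / 1                    ≡⟨ cong (_/ 1) (ℤₚ.pos-+ a b) ⟩
    (+ a ℤ.+ + b) / 1                  ≡˘⟨ cong (_/ 1) (cong₂ ℤ._+_ (ℤₚ.*-identityʳ (+ a)) (ℤₚ.*-identityʳ (+ b))) ⟩
    (+ a ℤ.* + 1 ℤ.+ + b ℤ.* + 1) / 1  ≡˘⟨ cong₂ _+_ (fromℕ≡mkℚ a) (fromℕ≡mkℚ b) ⟩
    fromℕ a + fromℕ b                  ∎
    where open ≡-Reasoning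

  fromℕ-mono-≤ : ∀ {a b} → a ℕ.≤ b → fromℕ a ≤ fromℕ b
  fromℕ-mono-≤ {a} {b} a≤b rewrite fromℕ≡mkℚ a | fromℕ≡mkℚ b =
    *≤* (ℤₚ.*-monoʳ-≤-nonNeg (+ 1) (ℤ.+≤+ a≤b))

  <⇒≱ : ∀ {p q} → p < q → ¬ q ≤ p
  <⇒≱ p<q q≤p = ℚₚ.<-irrefl refl (ℚₚ.<-≤-trans p<q q≤p)

  fromℕ-cancel-< : ∀ {a b} → fromℕ a < fromℕ b → a ℕ.< b
  fromℕ-cancel-< {a} {b} a<b with a ℕ.<? b
  ... | yes a<b′ = a<b′
  ... | no a≮b = contradiction (fromℕ-mono-≤ (ℕₚ.≮⇒≥ a≮b)) (<⇒≱ a<b)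

  +-cancelʳ-≤ : ∀ a b c → a + c ≤ b + c → a ≤ b
  +-cancelʳ-≤ a b c a+c≤b+c = ℚₚ.≮⇒≥ (λ b<a → <⇒≱ (ℚₚ.+-monoˡ-< c b<a) a+c≤b+c)

  halve-≤ : ∀ {a b} → a + a ≤ b + b → a ≤ b
  halve-≤ a+a≤b+b = ℚₚ.≮⇒≥ (λ b<a → <⇒≱ (ℚₚ.+-mono-< b<a b<a) a+a≤b+b)

  ≤-by-decision : ∀ {p q} {p≤q : True (p ℚₚ.≤? q)} → p ≤ q
  ≤-by-decision {p≤q = p≤q} = toWitness p≤q

  <-by-decision : ∀ {p q} {p<q : True (p ℚₚ.<? q)} → p < q
  <-by-decision {p<q = p<q} = toWitness p<q

  p≤q⇒0≤q-p : ∀ {p q} → p ≤ q → 0ℚ ≤ q - p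
  p≤q⇒0≤q-p {p} {q} p≤q = subst (_≤ q - p) (ℚₚ.+-inverseʳ p) (ℚₚ.+-monoˡ-≤ (- p) p≤q)

  ind-nonNeg : ∀ b → 0ℚ ≤ ind b
  ind-nonNeg true  = ≤-by-decision
  ind-nonNeg false = ℚₚ.≤-refl

  ind≤1 : ∀ b → ind b ≤ 1ℚ
  ind≤1 true  = ℚₚ.≤-refl
  ind≤1 false = ≤-by-decision

  ind-∧ : ∀ a b → ind (a ∧ b) ≡ ind a * ind b
  ind-∧ true  true  = refl
  ind-∧ true  false = refl
  ind-∧ false true  = refl
  ind-∧ false false = refl

  ∧≡true⇒ˡ : ∀ {a b} → a ∧ b ≡ true → a ≡ true
  ∧≡true⇒ˡ {true} _ = refl

  ∧≡false⇒ : ∀ a {b} → a ∧ b ≡ false → a ≡ false ⊎ b ≡ false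
  ∧≡false⇒ true  b≡false = inj₂ b≡false
  ∧≡false⇒ false _       = inj₁ refl

  sumFin≡sum : ∀ {n} (f : Fin n → ℚ) → sumFin f ≡ sum f
  sumFin≡sum {ℕ.zero}  f = refl
  sumFin≡sum {ℕ.suc n} f = cong (λ s → f zero + s) (sumFin≡sum (f ∘ suc))

  sum-mono-≤ : ∀ {n} {f g : Fin n → ℚ} → (∀ i → f i ≤ g i) → sum f ≤ sum g
  sum-mono-≤ {ℕ.zero}  f≤g = ℚₚ.≤-refl
  sum-mono-≤ {ℕ.suc n} f≤g = ℚₚ.+-mono-≤ (f≤g zero) (sum-mono-≤ (f≤g ∘ suc))

  ∃-<-of-sum-< : ∀ {n} {f g : Fin n → ℚ} → sum f < sum g → ∃ λ i → f i < g i
  ∃-<-of-sum-< {f = f} {g} Σf<Σg with Finₚ.any? (λ i → f i ℚₚ.<? g i)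
  ... | yes found = found
  ... | no none = contradiction (sum-mono-≤ (λ i → ℚₚ.≮⇒≥ (λ gi<fi → none (i , gi<fi)))) (<⇒≱ Σf<Σg)

  δ : ∀ {n} → Fin n → Fin n → ℚ
  δ i j = ind (does (i ≟ j))

  sum-δ : ∀ {n} (j : Fin n) (u : Fin n → ℚ) → ∑[ i < n ] (δ i j * u i) ≡ u j
  sum-δ {ℕ.suc n} zero u = begin
    1ℚ * u zero + ∑[ i < n ] (0ℚ * u (suc i))
      ≡⟨ cong₂ _+_ (ℚₚ.*-identityˡ (u zero))
                   (trans (sum-cong-≗ (λ i → ℚₚ.*-zeroˡ (u (suc i)))) (sum-replicate-zero n)) ⟩
    u zero + 0ℚ
      ≡⟨ ℚₚ.+-identityʳ (u zero) ⟩
    u zero ∎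
    where open ≡-Reasoning
  sum-δ {ℕ.suc n} (suc j) u = begin
    0ℚ * u zero + ∑[ i < n ] (δ i j * u (suc i))  ≡⟨ cong₂ _+_ (ℚₚ.*-zeroˡ (u zero)) (sum-δ j (u ∘ suc)) ⟩
    0ℚ + u (suc j)                                ≡⟨ ℚₚ.+-identityˡ (u (suc j)) ⟩
    u (suc j)                                     ∎
    where open ≡-Reasoning

  -- Subsets as characteristic functions: for χ the indicator of α, mass M χ is Σ_{i,j∈α} M i j
  -- and size χ is |α|.

  mass : ∀ {n} → Matrix n → (Fin n → Bool) → ℚ
  mass {n} M χ = ∑[ i < n ] ∑[ j < n ] (ind (χ i) * ind (χ j) * M i j)

  size : ∀ {n} → (Fin n → Bool) → ℚ
  size {n} χ = ∑[ i < n ] ind (χ i)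

  mass-cong : ∀ {n} (M : Matrix n) {χ ψ : Fin n → Bool} → χ ≗ ψ → mass M χ ≡ mass M ψ
  mass-cong M χ≗ψ = sum-cong-≗ (λ i → sum-cong-≗ (λ j → cong₂ (λ a b → ind a * ind b * M i j) (χ≗ψ i) (χ≗ψ j)))

  size-cong : ∀ {n} {χ ψ : Fin n → Bool} → χ ≗ ψ → size χ ≡ size ψ
  size-cong χ≗ψ = sum-cong-≗ (cong ind ∘ χ≗ψ)

  sumSub≡mass : ∀ {n} (α : Subset n) (M : Matrix n) → sumSub α M ≡ mass M (lookup α)
  sumSub≡mass {n} α M = trans (sumFin≡sum (λ i → sumFin (term i))) (sum-cong-≗ (λ i → sumFin≡sum (term i)))
    where
    term : Fin n → Fin n → ℚ
    term i j = ind (lookup α i) * ind (lookup α j) * M i j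

  card≡size : ∀ {n} (α : Subset n) → card α ≡ size (lookup α)
  card≡size []            = refl
  card≡size (inside ∷ α)  = trans (fromℕ-+ 1 ∣ α ∣) (cong (λ s → 1ℚ + s) (card≡size α))
  card≡size (outside ∷ α) = trans (card≡size α) (sym (ℚₚ.+-identityˡ _))

  mass-tabulate : ∀ {n} (M : Matrix n) (χ : Fin n → Bool) → sumSub (tabulate χ) M ≡ mass M χ
  mass-tabulate M χ = trans (sumSub≡mass (tabulate χ) M) (mass-cong M (Vecₚ.lookup∘tabulate χ))

  size-tabulate : ∀ {n} (χ : Fin n → Bool) → card (tabulate χ) ≡ size χ
  size-tabulate χ = trans (card≡size (tabulate χ)) (size-cong (Vecₚ.lookup∘tabulate χ))

  InU⇒mass≤size : ∀ {n} {M : Matrix n} → InU M → ∀ χ → mass M χ ≤ size χ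
  InU⇒mass≤size {M = M} (_ , _ , bounded) χ =
    subst₂ _≤_ (mass-tabulate M χ) (size-tabulate χ) (bounded (tabulate χ))

  mass-pointwise : ∀ {n} {M N : Matrix n} → (∀ x y → M x y ≡ N x y) → ∀ χ → mass M χ ≡ mass N χ
  mass-pointwise M≡N χ = sum-cong-≗ (λ i → sum-cong-≗ (λ j → cong (λ a → ind (χ i) * ind (χ j) * a) (M≡N i j)))

  mass-+ : ∀ {n} (M N : Matrix n) χ → mass (λ x y → M x y + N x y) χ ≡ mass M χ + mass N χ
  mass-+ {n} M N χ = begin
    ∑[ i < n ] ∑[ j < n ] (w i j * (M i j + N i j))
      ≡⟨ sum-cong-≗ (λ i → sum-cong-≗ (λ j → ℚₚ.*-distribˡ-+ (w i j) (M i j) (N i j))) ⟩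
    ∑[ i < n ] ∑[ j < n ] (w i j * M i j + w i j * N i j)
      ≡⟨ sum-cong-≗ (λ i → ∑-distrib-+ (λ j → w i j * M i j) (λ j → w i j * N i j)) ⟩
    ∑[ i < n ] (∑[ j < n ] (w i j * M i j) + ∑[ j < n ] (w i j * N i j))
      ≡⟨ ∑-distrib-+ (λ i → ∑[ j < n ] (w i j * M i j)) (λ i → ∑[ j < n ] (w i j * N i j)) ⟩
    mass M χ + mass N χ ∎
    where
    open ≡-Reasoning
    w : Fin n → Fin n → ℚ
    w i j = ind (χ i) * ind (χ j)

  mass-* : ∀ {n} c (M : Matrix n) χ → mass (λ x y → c * M x y) χ ≡ c * mass M χ
  mass-* {n} c M χ = begin
    ∑[ i < n ] ∑[ j < n ] (w i j * (c * M i j))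
      ≡⟨ sum-cong-≗ (λ i → sum-cong-≗ (λ j → regroup (w i j) (M i j))) ⟩
    ∑[ i < n ] ∑[ j < n ] (c * (w i j * M i j))
      ≡˘⟨ sum-cong-≗ (λ i → *-distribˡ-sum c (λ j → w i j * M i j)) ⟩
    ∑[ i < n ] (c * ∑[ j < n ] (w i j * M i j))
      ≡˘⟨ *-distribˡ-sum c (λ i → ∑[ j < n ] (w i j * M i j)) ⟩
    c * mass M χ ∎
    where
    open ≡-Reasoning
    w : Fin n → Fin n → ℚ
    w i j = ind (χ i) * ind (χ j)
    regroup : ∀ v a → v * (c * a) ≡ c * (v * a)
    regroup v a = solve 3 (λ v c a → v :* (c :* a) := c :* (v :* a)) refl v c a

  mass-neg : ∀ {n} (M : Matrix n) χ → mass (λ x y → - M x y) χ ≡ - mass M χ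
  mass-neg M χ = begin
    mass (λ x y → - M x y) χ       ≡⟨ mass-pointwise (λ x y → solve 1 (λ a → :- a := con (- 1ℚ) :* a) refl (M x y)) χ ⟩
    mass (λ x y → - 1ℚ * M x y) χ  ≡⟨ mass-* (- 1ℚ) M χ ⟩
    - 1ℚ * mass M χ                ≡⟨ solve 1 (λ a → con (- 1ℚ) :* a := :- a) refl (mass M χ) ⟩
    - mass M χ                     ∎
    where open ≡-Reasoning

  ind-supermodular : ∀ a b c d →
    ind a * ind b + ind c * ind d ≤ ind (a ∨ c) * ind (b ∨ d) + ind (a ∧ c) * ind (b ∧ d)
  ind-supermodular true  true  true  true  = ℚₚ.≤-refl
  ind-supermodular true  true  true  false = ℚₚ.≤-refl
  ind-supermodular true  true  false true  = ℚₚ.≤-refl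
  ind-supermodular true  true  false false = ℚₚ.≤-refl
  ind-supermodular true  false true  true  = ℚₚ.≤-refl
  ind-supermodular true  false true  false = ℚₚ.≤-refl
  ind-supermodular true  false false true  = ind-nonNeg true
  ind-supermodular true  false false false = ℚₚ.≤-refl
  ind-supermodular false true  true  true  = ℚₚ.≤-refl
  ind-supermodular false true  true  false = ind-nonNeg true
  ind-supermodular false true  false true  = ℚₚ.≤-refl
  ind-supermodular false true  false false = ℚₚ.≤-refl
  ind-supermodular false false true  true  = ℚₚ.≤-refl
  ind-supermodular false false true  false = ℚₚ.≤-refl
  ind-supermodular false false false true  = ℚₚ.≤-refl
  ind-supermodular false false false false = ℚₚ.≤-refl

  mass-supermodular : ∀ {n} {M : Matrix n} → (∀ i j → 0ℚ ≤ M i j) → ∀ χ ψ →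
    mass M χ + mass M ψ ≤ mass M (λ i → χ i ∨ ψ i) + mass M (λ i → χ i ∧ ψ i)
  mass-supermodular {n} {M} M≥0 χ ψ = begin
    mass M χ + mass M ψ                                       ≡˘⟨ ∑∑-distrib-+ χ ψ ⟩
    ∑[ i < n ] ∑[ j < n ] (w χ i j * M i j + w ψ i j * M i j)  ≤⟨ sum-mono-≤ (λ i → sum-mono-≤ (λ j → termwise i j)) ⟩
    ∑[ i < n ] ∑[ j < n ] (w ∪ i j * M i j + w ∩ i j * M i j)  ≡⟨ ∑∑-distrib-+ ∪ ∩ ⟩
    mass M ∪ + mass M ∩                                       ∎
    where
    open ℚₚ.≤-Reasoning
    ∪ ∩ : Fin n → Bool
    ∪ i = χ i ∨ ψ i
    ∩ i = χ i ∧ ψ i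
    w : (Fin n → Bool) → Fin n → Fin n → ℚ
    w φ i j = ind (φ i) * ind (φ j)
    ∑∑-distrib-+ : ∀ φ φ′ → ∑[ i < n ] ∑[ j < n ] (w φ i j * M i j + w φ′ i j * M i j) ≡ mass M φ + mass M φ′
    ∑∑-distrib-+ φ φ′ = trans (sum-cong-≗ (λ i → ∑-distrib-+ (λ j → w φ i j * M i j) (λ j → w φ′ i j * M i j)))
                               (∑-distrib-+ (λ i → ∑[ j < n ] (w φ i j * M i j)) (λ i → ∑[ j < n ] (w φ′ i j * M i j)))
    termwise : ∀ i j → w χ i j * M i j + w ψ i j * M i j ≤ w ∪ i j * M i j + w ∩ i j * M i j
    termwise i j = subst₂ _≤_ (ℚₚ.*-distribʳ-+ (M i j) (w χ i j) (w ψ i j))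
                              (ℚₚ.*-distribʳ-+ (M i j) (w ∪ i j) (w ∩ i j))
      (ℚₚ.*-monoʳ-≤-nonNeg (M i j) {{nonNegative (M≥0 i j)}} (ind-supermodular (χ i) (χ j) (ψ i) (ψ j)))

  size-modular : ∀ {n} (χ ψ : Fin n → Bool) → size χ + size ψ ≡ size (λ i → χ i ∨ ψ i) + size (λ i → χ i ∧ ψ i)
  size-modular χ ψ = begin
    size χ + size ψ                                                  ≡˘⟨ ∑-distrib-+ (ind ∘ χ) (ind ∘ ψ) ⟩
    sum (λ i → ind (χ i) + ind (ψ i))                                ≡⟨ sum-cong-≗ (λ i → ind-modular (χ i) (ψ i)) ⟩
    sum (λ i → ind (χ i ∨ ψ i) + ind (χ i ∧ ψ i))                    ≡⟨ ∑-distrib-+ (λ i → ind (χ i ∨ ψ i)) (λ i → ind (χ i ∧ ψ i)) ⟩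
    size (λ i → χ i ∨ ψ i) + size (λ i → χ i ∧ ψ i)                  ∎
    where
    open ≡-Reasoning
    ind-modular : ∀ a b → ind a + ind b ≡ ind (a ∨ b) + ind (a ∧ b)
    ind-modular true  true  = refl
    ind-modular true  false = refl
    ind-modular false true  = refl
    ind-modular false false = refl

  -- Restriction to the image of an injection

  image : ∀ {k m} → (Fin k → Fin m) → Fin m → Bool
  image f x = does (Finₚ.any? (λ i → f i ≟ x))

  module _ {k m} {f : Fin k → Fin m} (f-injective : Injective _≡_ _≡_ f) where

    count-preimage : ∀ x → ∑[ i < k ] δ x (f i) ≡ ind (image f x)
    count-preimage x with Finₚ.any? (λ i → f i ≟ x)
    ... | yes (i₀ , fi₀≡x) = begin
      ∑[ i < k ] δ x (f i)         ≡⟨ sum-cong-≗ (λ i → cong ind (does-⇔ (mk⇔ (x≡fi⇒i≡i₀ i) (i≡i₀⇒x≡fi i)) (x ≟ f i) (i ≟ i₀))) ⟩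
      ∑[ i < k ] δ i i₀            ≡˘⟨ sum-cong-≗ (λ i → ℚₚ.*-identityʳ (δ i i₀)) ⟩
      ∑[ i < k ] (δ i i₀ * 1ℚ)     ≡⟨ sum-δ i₀ (λ _ → 1ℚ) ⟩
      1ℚ                           ∎
      where
      open ≡-Reasoning
      x≡fi⇒i≡i₀ : ∀ i → x ≡ f i → i ≡ i₀
      x≡fi⇒i≡i₀ i x≡fi = f-injective (trans (sym x≡fi) (sym fi₀≡x))
      i≡i₀⇒x≡fi : ∀ i → i ≡ i₀ → x ≡ f i
      i≡i₀⇒x≡fi i refl = sym fi₀≡x
    ... | no ∄i = trans (sum-cong-≗ (λ i → cong ind (dec-false (x ≟ f i) (λ x≡fi → ∄i (i , sym x≡fi)))))
                        (sum-replicate-zero k)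

    sum-image : ∀ (u : Fin m → ℚ) → ∑[ x < m ] (ind (image f x) * u x) ≡ ∑[ i < k ] u (f i)
    sum-image u = begin
      ∑[ x < m ] (ind (image f x) * u x)         ≡˘⟨ sum-cong-≗ (λ x → cong (_* u x) (count-preimage x)) ⟩
      ∑[ x < m ] (∑[ i < k ] δ x (f i) * u x)    ≡⟨ sum-cong-≗ (λ x → *-distribʳ-sum (u x) (λ i → δ x (f i))) ⟩
      ∑[ x < m ] ∑[ i < k ] (δ x (f i) * u x)    ≡⟨ ∑-comm (λ x i → δ x (f i) * u x) ⟩
      ∑[ i < k ] ∑[ x < m ] (δ x (f i) * u x)    ≡⟨ sum-cong-≗ (λ i → sum-δ (f i) u) ⟩
      ∑[ i < k ] u (f i)                         ∎
      where open ≡-Reasoning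

    size-restrict : ∀ χ → size (λ x → χ x ∧ image f x) ≡ size (χ ∘ f)
    size-restrict χ = begin
      size (λ x → χ x ∧ image f x)            ≡⟨ sum-cong-≗ (λ x → trans (ind-∧ (χ x) (image f x)) (ℚₚ.*-comm (ind (χ x)) _)) ⟩
      ∑[ x < m ] (ind (image f x) * ind (χ x)) ≡⟨ sum-image (ind ∘ χ) ⟩
      size (χ ∘ f)                            ∎
      where open ≡-Reasoning

    mass-restrict : ∀ (M : Matrix m) χ → mass M (λ x → χ x ∧ image f x) ≡ mass (principal M f) (χ ∘ f)
    mass-restrict M χ = begin
      mass M (λ x → χ x ∧ image f x)
        ≡⟨ sum-cong-≗ (λ x → sum-cong-≗ (λ y → regroup x y)) ⟩
      ∑[ x < m ] ∑[ y < m ] (ind (image f x) * (ind (image f y) * term x y))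
        ≡˘⟨ sum-cong-≗ (λ x → *-distribˡ-sum (ind (image f x)) (λ y → ind (image f y) * term x y)) ⟩
      ∑[ x < m ] (ind (image f x) * ∑[ y < m ] (ind (image f y) * term x y))
        ≡⟨ sum-cong-≗ (λ x → cong (ind (image f x) *_) (sum-image (term x))) ⟩
      ∑[ x < m ] (ind (image f x) * ∑[ j < k ] term x (f j))
        ≡⟨ sum-image (λ x → ∑[ j < k ] term x (f j)) ⟩
      mass (principal M f) (χ ∘ f) ∎
      where
      open ≡-Reasoning
      term : Fin m → Fin m → ℚ
      term x y = ind (χ x) * ind (χ y) * M x y
      regroup : ∀ x y → ind (χ x ∧ image f x) * ind (χ y ∧ image f y) * M x y
                      ≡ ind (image f x) * (ind (image f y) * term x y)
      regroup x y rewrite ind-∧ (χ x) (image f x) | ind-∧ (χ y) (image f y) =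
        solve 5 (λ a b c d e → a :* b :* (c :* d) :* e := b :* (d :* (a :* c :* e))) refl
          (ind (χ x)) (ind (image f x)) (ind (χ y)) (ind (image f y)) (M x y)

  -- Half-integers

  HalfNatural : ℚ → Set
  HalfNatural x = Σ ℕ λ n → x + x ≡ fromℕ n

  ZeroHalfOne : ℚ → Set
  ZeroHalfOne v = v ≡ 0ℚ ⊎ v ≡ ½ ⊎ v ≡ 1ℚ

  zeroHalfOne-≤1 : ∀ {v} → ZeroHalfOne v → v ≤ 1ℚ
  zeroHalfOne-≤1 (inj₁ refl)        = ≤-by-decision
  zeroHalfOne-≤1 (inj₂ (inj₁ refl)) = ≤-by-decision
  zeroHalfOne-≤1 (inj₂ (inj₂ refl)) = ≤-by-decision

  zeroHalfOne-½≤ : ∀ {v} → ZeroHalfOne v → 0ℚ < v → ½ ≤ v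
  zeroHalfOne-½≤ (inj₁ refl)        0<0 = contradiction 0<0 (ℚₚ.<-irrefl refl)
  zeroHalfOne-½≤ (inj₂ (inj₁ refl)) _   = ℚₚ.≤-refl
  zeroHalfOne-½≤ (inj₂ (inj₂ refl)) _   = ≤-by-decision

  halfNatural-+ : ∀ {x y} → HalfNatural x → HalfNatural y → HalfNatural (x + y)
  halfNatural-+ {x} {y} (a , x+x≡a) (b , y+y≡b) = a ℕ.+ b , (begin
    (x + y) + (x + y)  ≡⟨ solve 2 (λ x y → (x :+ y) :+ (x :+ y) := (x :+ x) :+ (y :+ y)) refl x y ⟩
    (x + x) + (y + y)  ≡⟨ cong₂ _+_ x+x≡a y+y≡b ⟩
    fromℕ a + fromℕ b  ≡˘⟨ fromℕ-+ a b ⟩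
    fromℕ (a ℕ.+ b)    ∎)
    where open ≡-Reasoning

  halfNatural-sum : ∀ {n} (f : Fin n → ℚ) → (∀ i → HalfNatural (f i)) → HalfNatural (sum f)
  halfNatural-sum {ℕ.zero}  f _ = 0 , refl
  halfNatural-sum {ℕ.suc n} f h = halfNatural-+ {f zero} (h zero) (halfNatural-sum (f ∘ suc) (h ∘ suc))

  mass-halfNatural : ∀ {n} {M : Matrix n} → (∀ i j → ZeroHalfOne (M i j)) → ∀ χ → HalfNatural (mass M χ)
  mass-halfNatural M∈012 χ =
    halfNatural-sum _ (λ i → halfNatural-sum _ (λ j → masked (χ i) (χ j) (entry (M∈012 i j))))
    where
    entry : ∀ {v} → ZeroHalfOne v → HalfNatural v
    entry (inj₁ refl)        = 0 , refl
    entry (inj₂ (inj₁ refl)) = 1 , refl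
    entry (inj₂ (inj₂ refl)) = 2 , refl
    masked : ∀ a b {v} → HalfNatural v → HalfNatural (ind a * ind b * v)
    masked true  true  {v} h = subst HalfNatural (sym (ℚₚ.*-identityˡ v)) h
    masked true  false {v} _ = subst HalfNatural (sym (ℚₚ.*-zeroˡ v)) (0 , refl)
    masked false true  {v} _ = subst HalfNatural (sym (ℚₚ.*-zeroˡ v)) (0 , refl)
    masked false false {v} _ = subst HalfNatural (sym (ℚₚ.*-zeroˡ v)) (0 , refl)

  ≤∧≢⇒< : ∀ {p q} → p ≤ q → p ≢ q → p < q
  ≤∧≢⇒< p≤q p≢q = ℚₚ.≰⇒> (λ q≤p → p≢q (ℚₚ.≤-antisym p≤q q≤p))

  halfNatural-gap : ∀ {x} c → HalfNatural x → x ≤ fromℕ c → x ≢ fromℕ c → x + ½ ≤ fromℕ c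
  halfNatural-gap {x} c (n , x+x≡n) x≤c x≢c = halve-≤ (begin
    (x + ½) + (x + ½)  ≡⟨ solve 1 (λ x → (x :+ con ½) :+ (x :+ con ½) := con 1ℚ :+ (x :+ x)) refl x ⟩
    1ℚ + (x + x)       ≡⟨ cong (λ s → 1ℚ + s) x+x≡n ⟩
    1ℚ + fromℕ n       ≡˘⟨ fromℕ-+ 1 n ⟩
    fromℕ (ℕ.suc n)    ≤⟨ fromℕ-mono-≤ n<c+c ⟩
    fromℕ (c ℕ.+ c)    ≡⟨ fromℕ-+ c c ⟩
    fromℕ c + fromℕ c  ∎)
    where
    open ℚₚ.≤-Reasoning
    n<c+c : n ℕ.< c ℕ.+ c
    n<c+c = fromℕ-cancel-< (subst₂ _<_ x+x≡n (sym (fromℕ-+ c c)) (ℚₚ.+-mono-< x<c x<c))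
      where
      x<c : x < fromℕ c
      x<c = ≤∧≢⇒< x≤c x≢c

  -- Deficiency

  saturated-restrict : ∀ {n} {M : Matrix n} → InU M → ∀ {α} → mass M α ≡ size α → ∀ χ →
    mass M χ + size (λ i → χ i ∧ α i) ≤ size χ + mass M (λ i → χ i ∧ α i)
  saturated-restrict {n} {M} M∈U@(_ , M≥0 , _) {α} sat χ = +-cancelʳ-≤ _ _ (size α) (begin
    (mass M χ + size ∩) + size α     ≡⟨ cong (λ t → (mass M χ + size ∩) + t) (sym sat) ⟩
    (mass M χ + size ∩) + mass M α   ≡⟨ xy∙z≈xz∙y (mass M χ) (size ∩) (mass M α) ⟩
    (mass M χ + mass M α) + size ∩   ≤⟨ ℚₚ.+-monoˡ-≤ (size ∩) (mass-supermodular M≥0 χ α) ⟩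
    (mass M ∪ + mass M ∩) + size ∩   ≤⟨ ℚₚ.+-monoˡ-≤ (size ∩) (ℚₚ.+-monoˡ-≤ (mass M ∩) (InU⇒mass≤size M∈U ∪)) ⟩
    (size ∪ + mass M ∩) + size ∩     ≡⟨ xy∙z≈xz∙y (size ∪) (mass M ∩) (size ∩) ⟩
    (size ∪ + size ∩) + mass M ∩     ≡˘⟨ cong (_+ mass M ∩) (size-modular χ α) ⟩
    (size χ + size α) + mass M ∩     ≡⟨ xy∙z≈xz∙y (size χ) (size α) (mass M ∩) ⟩
    (size χ + mass M ∩) + size α     ∎)
    where
    open ℚₚ.≤-Reasoning
    ∪ ∩ : Fin n → Bool
    ∪ i = χ i ∨ α i
    ∩ i = χ i ∧ α i

  -- Perturbations

  ¼ : ℚ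
  ¼ = + 1 / 4

  unit : ∀ {n} → Fin n → Fin n → Matrix n
  unit p q x y = δ x p * δ y q

  symUnit : ∀ {n} → Fin n → Fin n → Matrix n
  symUnit p q x y = unit p q x y + unit q p x y

  perturb : ∀ {n} → Matrix n → (p q r s : Fin n) → Matrix n
  perturb A p q r s x y = A x y + ¼ * symUnit p q x y - ¼ * symUnit r s x y

  unit≡ind : ∀ {n} (p q x y : Fin n) → unit p q x y ≡ ind (does (x ≟ p) ∧ does (y ≟ q))
  unit≡ind p q x y = sym (ind-∧ (does (x ≟ p)) (does (y ≟ q)))

  unit-nonNeg : ∀ {n} (p q x y : Fin n) → 0ℚ ≤ unit p q x y
  unit-nonNeg p q x y = subst (0ℚ ≤_) (sym (unit≡ind p q x y)) (ind-nonNeg (does (x ≟ p) ∧ does (y ≟ q)))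

  unit≤1 : ∀ {n} (p q x y : Fin n) → unit p q x y ≤ 1ℚ
  unit≤1 p q x y = subst (_≤ 1ℚ) (sym (unit≡ind p q x y)) (ind≤1 (does (x ≟ p) ∧ does (y ≟ q)))

  unit-diag : ∀ {n} (p q : Fin n) → unit p q p q ≡ 1ℚ
  unit-diag p q with p ≟ p | q ≟ q
  ... | yes _ | yes _ = refl
  ... | no p≢p | _    = contradiction refl p≢p
  ... | yes _ | no q≢q = contradiction refl q≢q

  unit-off : ∀ {n} {p q x y : Fin n} → ¬ (x ≡ p × y ≡ q) → unit p q x y ≡ 0ℚ
  unit-off {p = p} {q} {x} {y} ≢ with x ≟ p | y ≟ q
  ... | yes x≡p | yes y≡q = contradiction (x≡p , y≡q) ≢
  ... | yes _   | no _    = refl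
  ... | no _    | yes _   = refl
  ... | no _    | no _    = refl

  symUnit-nonNeg : ∀ {n} (p q x y : Fin n) → 0ℚ ≤ symUnit p q x y
  symUnit-nonNeg p q x y = ℚₚ.+-mono-≤ (unit-nonNeg p q x y) (unit-nonNeg q p x y)

  symUnit≤2 : ∀ {n} (p q x y : Fin n) → symUnit p q x y ≤ 1ℚ + 1ℚ
  symUnit≤2 p q x y = ℚₚ.+-mono-≤ (unit≤1 p q x y) (unit≤1 q p x y)

  1≤symUnit-diag : ∀ {n} (p q : Fin n) → 1ℚ ≤ symUnit p q p q
  1≤symUnit-diag p q = ℚₚ.+-mono-≤ (ℚₚ.≤-reflexive (sym (unit-diag p q))) (unit-nonNeg q p p q)

  1≤symUnit-antidiag : ∀ {n} (p q : Fin n) → 1ℚ ≤ symUnit p q q p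
  1≤symUnit-antidiag p q = ℚₚ.+-mono-≤ (unit-nonNeg p q q p) (ℚₚ.≤-reflexive (sym (unit-diag q p)))

  symUnit-off : ∀ {n} {p q x y : Fin n} → ¬ (x ≡ p × y ≡ q) → ¬ (x ≡ q × y ≡ p) → symUnit p q x y ≡ 0ℚ
  symUnit-off ≢pq ≢qp = cong₂ _+_ (unit-off ≢pq) (unit-off ≢qp)

  symUnit-sym : ∀ {n} (p q x y : Fin n) → symUnit p q x y ≡ symUnit p q y x
  symUnit-sym p q x y = solve 4 (λ a b c d → a :* b :+ c :* d := d :* c :+ b :* a) refl (δ x p) (δ y q) (δ x q) (δ y p)

  mass-unit : ∀ {n} (p q : Fin n) χ → mass (unit p q) χ ≡ ind (χ p) * ind (χ q)
  mass-unit {n} p q χ = begin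
    ∑[ x < n ] ∑[ y < n ] (w x y * (δ x p * δ y q))   ≡⟨ sum-cong-≗ (λ x → sum-cong-≗ (λ y → regroup x y)) ⟩
    ∑[ x < n ] ∑[ y < n ] (δ x p * (δ y q * w x y))   ≡˘⟨ sum-cong-≗ (λ x → *-distribˡ-sum (δ x p) (λ y → δ y q * w x y)) ⟩
    ∑[ x < n ] (δ x p * ∑[ y < n ] (δ y q * w x y))   ≡⟨ sum-cong-≗ (λ x → cong (δ x p *_) (sum-δ q (w x))) ⟩
    ∑[ x < n ] (δ x p * w x q)                        ≡⟨ sum-δ p (λ x → w x q) ⟩
    w p q                                             ∎
    where
    open ≡-Reasoning
    w : Fin n → Fin n → ℚ
    w x y = ind (χ x) * ind (χ y)
    regroup : ∀ x y → w x y * (δ x p * δ y q) ≡ δ x p * (δ y q * w x y)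
    regroup x y = solve 3 (λ w a b → w :* (a :* b) := a :* (b :* w)) refl (w x y) (δ x p) (δ y q)

  mass-symUnit : ∀ {n} (p q : Fin n) χ → mass (symUnit p q) χ ≡ ind (χ p) * ind (χ q) + ind (χ q) * ind (χ p)
  mass-symUnit p q χ = trans (mass-+ (unit p q) (unit q p) χ) (cong₂ _+_ (mass-unit p q χ) (mass-unit q p χ))

  mass-perturb : ∀ {n} (A : Matrix n) (p q r s : Fin n) χ →
    mass (perturb A p q r s) χ ≡ mass A χ + (½ * ind (χ p ∧ χ q) - ½ * ind (χ r ∧ χ s))
  mass-perturb A p q r s χ = begin
    mass (perturb A p q r s) χ
      ≡⟨ mass-+ (λ x y → A x y + ¼ * symUnit p q x y) (λ x y → - (¼ * symUnit r s x y)) χ ⟩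
    mass (λ x y → A x y + ¼ * symUnit p q x y) χ + mass (λ x y → - (¼ * symUnit r s x y)) χ
      ≡⟨ cong₂ _+_ (mass-+ A (λ x y → ¼ * symUnit p q x y) χ) (mass-neg (λ x y → ¼ * symUnit r s x y) χ) ⟩
    mass A χ + mass (λ x y → ¼ * symUnit p q x y) χ - mass (λ x y → ¼ * symUnit r s x y) χ
      ≡⟨ cong₂ (λ u v → mass A χ + u - v) (mass-* ¼ (symUnit p q) χ) (mass-* ¼ (symUnit r s) χ) ⟩
    mass A χ + ¼ * mass (symUnit p q) χ - ¼ * mass (symUnit r s) χ
      ≡⟨ cong₂ (λ u v → mass A χ + ¼ * u - ¼ * v) (mass-symUnit p q χ) (mass-symUnit r s χ) ⟩
    mass A χ + ¼ * (ind (χ p) * ind (χ q) + ind (χ q) * ind (χ p)) - ¼ * (ind (χ r) * ind (χ s) + ind (χ s) * ind (χ r))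
      ≡⟨ cong₂ (λ u v → mass A χ + u - v) (quarter-twice (χ p) (χ q)) (quarter-twice (χ r) (χ s)) ⟩
    mass A χ + ½ * ind (χ p ∧ χ q) - ½ * ind (χ r ∧ χ s)
      ≡⟨ ℚₚ.+-assoc (mass A χ) _ _ ⟩
    mass A χ + (½ * ind (χ p ∧ χ q) - ½ * ind (χ r ∧ χ s)) ∎
    where
    open ≡-Reasoning
    quarter-twice : ∀ a b → ¼ * (ind a * ind b + ind b * ind a) ≡ ½ * ind (a ∧ b)
    quarter-twice a b rewrite ind-∧ a b =
      solve 2 (λ x y → con ¼ :* (x :* y :+ y :* x) := con ½ :* (x :* y)) refl (ind a) (ind b)

  perturb-sym : ∀ {n} {A : Matrix n} → (∀ x y → A x y ≡ A y x) → ∀ p q r s x y →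
    perturb A p q r s x y ≡ perturb A p q r s y x
  perturb-sym A-sym p q r s x y =
    cong₂ (λ a (uv : ℚ × ℚ) → a + ¼ * proj₁ uv - ¼ * proj₂ uv) (A-sym x y)
      (cong₂ _,_ (symUnit-sym p q x y) (symUnit-sym r s x y))

  perturb-nonNeg : ∀ {n} {A : Matrix n} {p q r s : Fin n} → (∀ x y → A x y ≡ A y x) → (∀ x y → 0ℚ ≤ A x y) →
    ½ ≤ A r s → ∀ x y → 0ℚ ≤ perturb A p q r s x y
  perturb-nonNeg {A = A} {p} {q} {r} {s} A-sym A≥0 ½≤Ars x y = p≤q⇒0≤q-p (begin
    ¼ * symUnit r s x y           ≤⟨ removed≤A ⟩
    A x y                         ≡˘⟨ ℚₚ.+-identityʳ (A x y) ⟩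
    A x y + 0ℚ                    ≤⟨ ℚₚ.+-monoʳ-≤ (A x y) (ℚₚ.*-monoˡ-≤-nonNeg ¼ (symUnit-nonNeg p q x y)) ⟩
    A x y + ¼ * symUnit p q x y   ∎)
    where
    open ℚₚ.≤-Reasoning
    removed≤½ : ¼ * symUnit r s x y ≤ ½
    removed≤½ = ℚₚ.*-monoˡ-≤-nonNeg ¼ (symUnit≤2 r s x y)
    removed≤A : ¼ * symUnit r s x y ≤ A x y
    removed≤A with x ≟ r ×-dec y ≟ s | x ≟ s ×-dec y ≟ r
    ... | yes (refl , refl) | _                 = ℚₚ.≤-trans removed≤½ ½≤Ars
    ... | no _              | yes (refl , refl) = ℚₚ.≤-trans removed≤½ (subst (½ ≤_) (A-sym r s) ½≤Ars)
    ... | no ≢rs            | no ≢sr            = subst (λ t → ¼ * t ≤ A x y) (sym (symUnit-off ≢rs ≢sr)) (A≥0 x y)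

  shift-≤ : ∀ {m s} a b → (a ≡ true → b ≡ false → m + ½ ≤ s) → m ≤ s → m + (½ * ind a - ½ * ind b) ≤ s
  shift-≤ true  false m+½≤s _   = m+½≤s refl refl
  shift-≤ true  true  _     m≤s = ℚₚ.≤-trans (ℚₚ.≤-reflexive (ℚₚ.+-identityʳ _)) m≤s
  shift-≤ false false _     m≤s = ℚₚ.≤-trans (ℚₚ.≤-reflexive (ℚₚ.+-identityʳ _)) m≤s
  shift-≤ {m} false true  _     m≤s =
    ℚₚ.≤-trans (ℚₚ.+-monoʳ-≤ m ≤-by-decision) (ℚₚ.≤-trans (ℚₚ.≤-reflexive (ℚₚ.+-identityʳ m)) m≤s)

  perturb-InU : ∀ {n} {A : Matrix n} {p q r s : Fin n} → InU A → ½ ≤ A r s →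
    (∀ χ → χ p ∧ χ q ≡ true → χ r ∧ χ s ≡ false → mass A χ + ½ ≤ size χ) →
    InU (perturb A p q r s)
  perturb-InU {A = A} {p} {q} {r} {s} A∈U@(A-sym , A≥0 , _) ½≤Ars deficient =
    perturb-sym A-sym p q r s , perturb-nonNeg A-sym A≥0 ½≤Ars , bounded
    where
    bounded : ∀ α → sumSub α (perturb A p q r s) ≤ card α
    bounded α = subst₂ _≤_ (sym (trans (sumSub≡mass α _) (mass-perturb A p q r s χ))) (sym (card≡size α))
      (shift-≤ (χ p ∧ χ q) (χ r ∧ χ s) (deficient χ) (InU⇒mass≤size A∈U χ))
      where χ = lookup α

  perturb-midpoint : ∀ {n} (A : Matrix n) p q r s x y →
    A x y ≡ ½ * perturb A p q r s x y + (1ℚ - ½) * perturb A r s p q x y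
  perturb-midpoint A p q r s x y =
    solve 3 (λ a u v → a := con ½ :* (a :+ con ¼ :* u :- con ¼ :* v)
                          :+ (con 1ℚ :- con ½) :* (a :+ con ¼ :* v :- con ¼ :* u))
      refl (A x y) (symUnit p q x y) (symUnit r s x y)

  perturb-swap-≡ : ∀ {n} (A : Matrix n) p q r s x y →
    perturb A p q r s x y ≡ perturb A r s p q x y → symUnit p q x y ≡ symUnit r s x y
  perturb-swap-≡ A p q r s x y B≡C = begin
    u                          ≡⟨ solve 3 (λ a u v → u := v :+ con (1ℚ + 1ℚ) :* ((a :+ con ¼ :* u :- con ¼ :* v)
                                                                            :- (a :+ con ¼ :* v :- con ¼ :* u)))
                                          refl (A x y) u v ⟩
    v + (1ℚ + 1ℚ) * (b - c)    ≡⟨ cong (λ t → v + (1ℚ + 1ℚ) * (t - c)) B≡C ⟩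
    v + (1ℚ + 1ℚ) * (c - c)    ≡⟨ solve 2 (λ v c → v :+ con (1ℚ + 1ℚ) :* (c :- c) := v) refl v c ⟩
    v                          ∎
    where
    open ≡-Reasoning
    u v b c : ℚ
    u = symUnit p q x y
    v = symUnit r s x y
    b = perturb A p q r s x y
    c = perturb A r s p q x y

  full : ∀ {n} → Fin n → Bool
  full _ = true

  size-full : ∀ n → size {n} full ≡ fromℕ n
  size-full n = begin
    size {n} full          ≡˘⟨ size-cong {n} (λ i → Vecₚ.lookup-replicate i inside) ⟩
    size (lookup (⊤ {n}))  ≡˘⟨ card≡size (⊤ {n}) ⟩
    fromℕ ∣ ⊤ {n} ∣        ≡⟨ cong fromℕ (∣⊤∣≡n n) ⟩
    fromℕ n                ∎
    where open ≡-Reasoning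

  ∃-<-of-mass-< : ∀ {n} {M N : Matrix n} → mass N full < mass M full → ∃₂ λ i j → N i j < M i j
  ∃-<-of-mass-< {M = M} {N} ΣN<ΣM with ∃-<-of-sum-< ΣN<ΣM
  ... | i , ΣNi<ΣMi with ∃-<-of-sum-< ΣNi<ΣMi
  ... | j , Nij<Mij = i , j , subst₂ _<_ (ℚₚ.*-identityˡ (N i j)) (ℚₚ.*-identityˡ (M i j)) Nij<Mij

  ∃-positive-entry : ∀ {n} {M : Matrix n} → 0ℚ < mass M full → ∃₂ λ i j → 0ℚ < M i j
  ∃-positive-entry {n} {M} 0<ΣM = ∃-<-of-mass-< (subst (_< mass M full) (sym mass-zero) 0<ΣM)
    where
    mass-zero : mass {n} (λ _ _ → 0ℚ) full ≡ 0ℚ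
    mass-zero = trans (sum-cong-≗ {n} (λ _ → sum-replicate-zero n)) (sum-replicate-zero n)

  mass-symUnit-full : ∀ {n} (p q : Fin n) → mass (symUnit p q) full ≡ 1ℚ + 1ℚ
  mass-symUnit-full p q = trans (mass-symUnit p q full) (cong₂ _+_ (ℚₚ.*-identityˡ 1ℚ) (ℚₚ.*-identityˡ 1ℚ))

  ∃-positive-entry-elsewhere : ∀ {n} {M : Matrix n} → (∀ i j → M i j ≤ 1ℚ) → 1ℚ + 1ℚ < mass M full →
    ∀ a b → ∃₂ λ c d → 0ℚ < M c d × ¬ (a ≡ c × b ≡ d) × ¬ (a ≡ d × b ≡ c)
  ∃-positive-entry-elsewhere {M = M} M≤1 2<ΣM a b =
    away (∃-<-of-mass-< {M = M} {N = symUnit a b} (subst (_< mass M full) (sym (mass-symUnit-full a b)) 2<ΣM))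
    where
    away : (∃₂ λ c d → symUnit a b c d < M c d) →
           ∃₂ λ c d → 0ℚ < M c d × ¬ (a ≡ c × b ≡ d) × ¬ (a ≡ d × b ≡ c)
    away (c , d , S<M) = c , d , ℚₚ.≤-<-trans (symUnit-nonNeg a b c d) S<M
      , (λ { (refl , refl) → <⇒≱ S<M (ℚₚ.≤-trans (M≤1 a b) (1≤symUnit-diag a b)) })
      , (λ { (refl , refl) → <⇒≱ S<M (ℚₚ.≤-trans (M≤1 b a) (1≤symUnit-antidiag a b)) })

  module _ {k} {P : Matrix k} (P-F : IsF P) where

    private
      P∈U : InU P
      P∈U = proj₁ (proj₁ P-F)
      P∈012 : ∀ i j → ZeroHalfOne (P i j)
      P∈012 = proj₂ (proj₂ (proj₁ P-F))

    IsF⇒mass-full : mass P full ≡ fromℕ k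
    IsF⇒mass-full = begin
      mass P full      ≡˘⟨ mass-cong P (λ i → Vecₚ.lookup-replicate i inside) ⟩
      mass P (lookup ⊤) ≡˘⟨ sumSub≡mass ⊤ P ⟩
      sumSub ⊤ P       ≡⟨ proj₂ (proj₁ (proj₂ P-F)) ⟩
      fromℕ ∣ ⊤ {k} ∣  ≡⟨ cong fromℕ (∣⊤∣≡n k) ⟩
      fromℕ k          ∎
      where open ≡-Reasoning

    IsF⇒deficient : ∀ χ {a c} → χ a ≡ true → χ c ≡ false → mass P χ + ½ ≤ size χ
    IsF⇒deficient χ {a} {c} χa χc = subst (mass P χ + ½ ≤_) (size-tabulate χ)
      (halfNatural-gap ∣ T ∣ (mass-halfNatural P∈012 χ) mass≤card mass≢card)
      where
      T : Subset k
      T = tabulate χ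
      mass≤card : mass P χ ≤ card T
      mass≤card = subst (mass P χ ≤_) (sym (size-tabulate χ)) (InU⇒mass≤size P∈U χ)
      mass≢card : mass P χ ≢ card T
      mass≢card saturated = proj₂ (proj₂ P-F) T nonempty T≢⊤ (nonempty , trans (mass-tabulate P χ) saturated)
        where
        nonempty : Nonempty T
        nonempty = a , Vecₚ.lookup⇒[]= a T (trans (Vecₚ.lookup∘tabulate χ a) χa)
        T≢⊤ : T ≢ ⊤
        T≢⊤ T≡⊤ = contradiction (trans (sym Tc≡false) Tc≡true) λ ()
          where
          Tc≡false : lookup T c ≡ false
          Tc≡false = trans (Vecₚ.lookup∘tabulate χ c) χc
          Tc≡true : lookup T c ≡ true
          Tc≡true = trans (cong (λ U → lookup U c) T≡⊤) (Vecₚ.lookup-replicate c inside)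

    IsF⇒2<mass-full : 3 ℕ.≤ k → 1ℚ + 1ℚ < mass P full
    IsF⇒2<mass-full 3≤k = subst (1ℚ + 1ℚ <_) (sym IsF⇒mass-full)
      (ℚₚ.<-≤-trans (<-by-decision {1ℚ + 1ℚ} {fromℕ 3}) (fromℕ-mono-≤ 3≤k))

    IsF⇒two-positive-entries : 3 ℕ.≤ k → ∃₂ λ a b → ∃₂ λ c d →
      0ℚ < P a b × 0ℚ < P c d × ¬ (a ≡ c × b ≡ d) × ¬ (a ≡ d × b ≡ c)
    IsF⇒two-positive-entries 3≤k =
      let a , b , 0<Pab = ∃-positive-entry {M = P} (ℚₚ.<-trans (<-by-decision {0ℚ} {1ℚ + 1ℚ}) (IsF⇒2<mass-full 3≤k))
          c , d , others = ∃-positive-entry-elsewhere {M = P} P≤1 (IsF⇒2<mass-full 3≤k) a b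
      in a , b , c , d , 0<Pab , others
      where
      P≤1 : ∀ i j → P i j ≤ 1ℚ
      P≤1 i j = zeroHalfOne-≤1 (P∈012 i j)

  module _ {m k} {A : Matrix m} {f : Fin k → Fin m}
           (A∈012 : InU012 A) (f-injective : Injective _≡_ _≡_ f) (P-F : IsF (principal A f)) where

    private
      A∈U : InU A
      A∈U = proj₁ A∈012

    image-saturated : mass A (image f) ≡ size (image f)
    image-saturated = begin
      mass A (image f)           ≡⟨ mass-restrict f-injective A full ⟩
      mass (principal A f) full  ≡⟨ IsF⇒mass-full P-F ⟩
      fromℕ k                    ≡˘⟨ size-full k ⟩
      size {k} full              ≡˘⟨ size-restrict f-injective full ⟩
      size (image f)             ∎
      where open ≡-Reasoning

    cut-deficient : ∀ χ {a c} → χ (f a) ≡ true → χ (f c) ≡ false → mass A χ + ½ ≤ size χ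
    cut-deficient χ χfa χfc = +-cancelʳ-≤ (mass A χ + ½) (size χ) (mass A ∩) (begin
      (mass A χ + ½) + mass A ∩  ≡⟨ xy∙z≈x∙zy (mass A χ) ½ (mass A ∩) ⟩
      mass A χ + (mass A ∩ + ½)  ≤⟨ ℚₚ.+-monoʳ-≤ (mass A χ) restricted ⟩
      mass A χ + size ∩          ≤⟨ saturated-restrict A∈U image-saturated χ ⟩
      size χ + mass A ∩          ∎)
      where
      open ℚₚ.≤-Reasoning
      ∩ : Fin m → Bool
      ∩ x = χ x ∧ image f x
      restricted : mass A ∩ + ½ ≤ size ∩
      restricted = subst₂ (λ u v → u + ½ ≤ v) (sym (mass-restrict f-injective A χ)) (sym (size-restrict f-injective χ))
        (IsF⇒deficient P-F (χ ∘ f) χfa χfc)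

    perturb-image-InU : ∀ {a b c d} → 0ℚ < principal A f c d → InU (perturb A (f a) (f b) (f c) (f d))
    perturb-image-InU {a} {b} {c} {d} 0<Acd = perturb-InU A∈U (zeroHalfOne-½≤ (proj₂ (proj₂ A∈012) (f c) (f d)) 0<Acd) deficient
      where
      deficient : ∀ χ → χ (f a) ∧ χ (f b) ≡ true → χ (f c) ∧ χ (f d) ≡ false → mass A χ + ½ ≤ size χ
      deficient χ ab rs with ∧≡false⇒ (χ (f c)) rs
      ... | inj₁ χfc = cut-deficient χ (∧≡true⇒ˡ ab) χfc
      ... | inj₂ χfd = cut-deficient χ (∧≡true⇒ˡ ab) χfd

    not-extreme-at : ∀ {a b c d} → 0ℚ < principal A f a b → 0ℚ < principal A f c d →
      ¬ (a ≡ c × b ≡ d) → ¬ (a ≡ d × b ≡ c) → ¬ IsExtremeU A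
    not-extreme-at {a} {b} {c} {d} 0<Pab 0<Pcd ab≢cd ab≢dc (_ , extreme) =
      <⇒≱ (<-by-decision {0ℚ} {1ℚ}) (subst (1ℚ ≤_) (trans S≡S′ S′≡0) (1≤symUnit-diag p q))
      where
      p q r s : Fin m
      p = f a
      q = f b
      r = f c
      s = f d
      S≡S′ : symUnit p q p q ≡ symUnit r s p q
      S≡S′ = perturb-swap-≡ A p q r s p q
        (extreme _ _ ½ (perturb-image-InU 0<Pcd) (perturb-image-InU 0<Pab)
                 (<-by-decision {0ℚ} {½}) (<-by-decision {½} {1ℚ}) (perturb-midpoint A p q r s) p q)
      S′≡0 : symUnit r s p q ≡ 0ℚ
      S′≡0 = symUnit-off (λ (p≡r , q≡s) → ab≢cd (f-injective p≡r , f-injective q≡s))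
                         (λ (p≡s , q≡r) → ab≢dc (f-injective p≡s , f-injective q≡r))

    not-extreme : 3 ℕ.≤ k → ¬ IsExtremeU A
    not-extreme 3≤k =
      let _ , _ , _ , _ , 0<Pab , 0<Pcd , ab≢cd , ab≢dc = IsF⇒two-positive-entries P-F 3≤k
      in not-extreme-at 0<Pab 0<Pcd ab≢cd ab≢dc

  strictlyIncreasing⇒injective : ∀ {k m} (f : Fin k → Fin m) → StrictlyIncreasing f → Injective _≡_ _≡_ f
  strictlyIncreasing⇒injective f f-increasing {i} {j} fi≡fj with Finₚ.<-cmp i j
  ... | tri< i<j _ _ = contradiction fi≡fj (Finₚ.<⇒≢ (f-increasing i j i<j))
  ... | tri≈ _ i≡j _ = i≡j
  ... | tri> _ _ j<i = contradiction (sym fi≡fj) (Finₚ.<⇒≢ (f-increasing j i j<i))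

open import Data.Nat using (ℕ; _≤_)

proposition3p9 : (m : ℕ) (A : Matrix m) → InU012 A
    → (k : ℕ) → 3 ≤ k → (f : Fin k → Fin m) → StrictlyIncreasing f
    → IsF (principal A f)
    → ¬ IsExtremeU A
proposition3p9 m A A∈012 k 3≤k f f-increasing P-F =
  not-extreme A∈012 (strictlyIncreasing⇒injective f f-increasing) P-F 3≤k
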